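{- Let $n\ge 1$ and let $x,y$ satisfy $x+y\neq 0$. Then $T_n(x,y)$ is invertible and $$R_n^T\,T_n(x,y)^{ -1}\,R_n=(-1)^n\,\frac{xy}{x+y}\,\mathbf u_n\mathbf u_n^T,$$ where $\mathbf u_n\in\mathbb R^{2n-1}$ has components $(\mathbf u_n)_j=0$ for $j$ even and $(\mathbf u_n)_j=(-1)^{(j-1)/2}$ for $j$ odd, i.e. $\mathbf u_n=(1,0,-1,0,1,\dots)^T$. In particular $R_n^T T_n(x,y)^{ -1}R_n$ is a $(2n-1)\times(2n-1)$ matrix of rank one (when $xy\neq 0$).
   Context: For $n\ge 1$, $T_n(x,y)$ is the $(2n+1)\times(2n+1)$ matrix with entries equal to $1$ in positions $(i,i+1)$ and $(i+1,i)$ for $1\le i\le 2n$, entry $y$ in position $(1,2n+1)$, entry $x$ in position $(2n+1,1)$, and $0$ elsewhere; its determinant is $x+y$. $R_n$ is the $(2n+1)\times(2n-1)$ matrix with $(R_n)_{i,j}=1$ if $j$ is odd and $i=j+1$, and $(R_n)_{i,j}=0$ otherwise. -}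

module Defs where

open import Level using (Level)
open import Algebra.Bundles using (CommutativeRing)
open import Data.Nat as ℕ using (ℕ; zero; suc; _≡ᵇ_)
open import Data.Nat.Base using (_%_; _/_)
open import Data.Fin using (Fin; toℕ)
open import Data.Bool using (Bool; true; false; if_then_else_; _∧_; _∨_)
open import Data.Product using (Σ; _×_)

-- Matrices over a commutative ring, as functions Fin m → Fin k → Carrier,
-- with 0-based indices (paper's index i corresponds to toℕ i + 1).
module Matrices {c ℓ : Level} (Rng : CommutativeRing c ℓ) where
  open CommutativeRing Rng

  Mat : ℕ → ℕ → Set c
  Mat m k = Fin m → Fin k → Carrier

  Vec′ : ℕ → Set c
  Vec′ m = Fin m → Carrier

  _≋_ : {m k : ℕ} → Mat m k → Mat m k → Set ℓ
  A ≋ B = ∀ i j → A i j ≈ B i j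

  sumFin : {k : ℕ} → (Fin k → Carrier) → Carrier
  sumFin {zero}  f = 0#
  sumFin {suc k} f = f Fin.zero + sumFin (λ i → f (Fin.suc i))

  _·_ : {m k l : ℕ} → Mat m k → Mat k l → Mat m l
  (A · B) i j = sumFin (λ t → A i t * B t j)

  transpose : {m k : ℕ} → Mat m k → Mat k m
  transpose A i j = A j i

  idMat : {m : ℕ} → Mat m m
  idMat i j = if toℕ i ≡ᵇ toℕ j then 1# else 0#

  scale : {m k : ℕ} → Carrier → Mat m k → Mat m k
  scale a A i j = a * A i j

  outer : {m k : ℕ} → Vec′ m → Vec′ k → Mat m k
  outer u v i j = u i * v j

  signPow : ℕ → Carrier
  signPow zero    = 1#
  signPow (suc n) = - signPow n

  Tmat : (n : ℕ) → Carrier → Carrier → Mat (2 ℕ.* n ℕ.+ 1) (2 ℕ.* n ℕ.+ 1)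
  Tmat n x y i j =
    if (toℕ j ≡ᵇ suc (toℕ i)) ∨ (toℕ i ≡ᵇ suc (toℕ j)) then 1#
    else if (toℕ i ≡ᵇ 0) ∧ (toℕ j ≡ᵇ 2 ℕ.* n) then y
    else if (toℕ i ≡ᵇ 2 ℕ.* n) ∧ (toℕ j ≡ᵇ 0) then x
    else 0#

  -- R_n: (2n+1)×(2n-1), paper entry (i,j) = 1 iff j odd and i = j+1.
  -- In 0-based indices i0 = i-1, j0 = j-1: entry 1 iff j0 even and i0 = j0+1.
  Rmat : (n : ℕ) → Mat (2 ℕ.* n ℕ.+ 1) (2 ℕ.* n ℕ.∸ 1)
  Rmat n i j = if (toℕ j % 2 ≡ᵇ 0) ∧ (toℕ i ≡ᵇ suc (toℕ j)) then 1# else 0#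

  -- u_n ∈ R^{2n-1}: paper (u_n)_j = 0 for j even, (-1)^{(j-1)/2} for j odd.
  -- 0-based j0 = j-1: 0 for j0 odd, (-1)^{j0/2} for j0 even.
  uvec : (n : ℕ) → Vec′ (2 ℕ.* n ℕ.∸ 1)
  uvec n j = if toℕ j % 2 ≡ᵇ 0 then signPow (toℕ j / 2) else 0#

module Submission where

-- Away from its two corner rows T acts on a column v by (T v) i = v (i - 1) + v (i + 1), so a column of
-- T⁻¹ satisfies v (i + 2) = - v i except across the diagonal: it is sign i = (-1)^⌊i/2⌋ times a constant
-- depending only on the parity of i and on the side of the diagonal i lies on. The corner rows, the only
-- ones involving x and y, pin these constants down (kernel below), up to the factor d = 1/(x+y).
-- Transposing T or T⁻¹ swaps x and y, so the right inverse is also a left inverse. Finally Rᵀ T⁻¹ R is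
-- the submatrix of T⁻¹ on odd (0-based) rows and columns, where the entry at (i, j) is
-- (-1)^n x y d · sign i · sign j, and sign (2a + 1) = (-1)^a is the a-th non-zero entry of u.

open import Defs
open import Level using (Level)
open import Algebra.Bundles using (CommutativeMonoid; CommutativeRing)
open import Data.Nat using (ℕ; _≤_)
open import Data.Product using (Σ; _×_; _,_; proj₁)
open import Data.Bool using (Bool; true; false; T; not; if_then_else_; _∧_; _∨_)
open import Data.Bool.Properties using (∨-comm; ∧-comm; T-∧)
open import Data.Empty using (⊥; ⊥-elim)
open import Data.Fin using (Fin; toℕ)
open import Data.Fin.Properties using (toℕ<n)
open import Data.Nat as ℕ using (zero; suc; _<_; _<ᵇ_; _≡ᵇ_; _≟_; z≤n; s≤s; _%_; _/_; parity)
open import Data.Nat.DivMod using (m*n%n≡0; m*n/n≡m; [m+kn]%n≡m%n)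
import Data.Nat.Properties as ℕP
open ℕP using (suc-injective; ≡ᵇ⇒≡; ≤-trans; n≤1+n; n<1+n; m<n⇒m<1+n; m≢1+n+m; m≤n⇒m<n∨m≡n;
               m≤n⇒m≤1+n; *-cancelʳ-≤; *-monoˡ-≤; <⇒≢)
open import Data.Parity.Base using (Parity; 0ℙ; 1ℙ)
open import Data.Sum using (inj₁; inj₂)
open import Function using (_∘_; _$_)
open import Function.Bundles using (Equivalence)
open import Relation.Nullary using (yes; no)
import Relation.Binary.PropositionalEquality as ≡
open ≡ using (_≡_; _≢_)

≡ᵇ-refl : ∀ n → (n ≡ᵇ n) ≡ true
≡ᵇ-refl zero    = ≡.refl
≡ᵇ-refl (suc n) = ≡ᵇ-refl n

≢⇒≡ᵇ-false : ∀ {m n} → m ≢ n → (m ≡ᵇ n) ≡ false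
≢⇒≡ᵇ-false {zero}  {zero}  m≢n = ⊥-elim (m≢n ≡.refl)
≢⇒≡ᵇ-false {zero}  {suc n} _   = ≡.refl
≢⇒≡ᵇ-false {suc m} {zero}  _   = ≡.refl
≢⇒≡ᵇ-false {suc m} {suc n} m≢n = ≢⇒≡ᵇ-false (m≢n ∘ ≡.cong suc)

≡ᵇ-sym : ∀ m n → (m ≡ᵇ n) ≡ (n ≡ᵇ m)
≡ᵇ-sym zero    zero    = ≡.refl
≡ᵇ-sym zero    (suc n) = ≡.refl
≡ᵇ-sym (suc m) zero    = ≡.refl
≡ᵇ-sym (suc m) (suc n) = ≡ᵇ-sym m n

n<ᵇ1+n : ∀ n → (n <ᵇ suc n) ≡ true
n<ᵇ1+n zero    = ≡.refl
n<ᵇ1+n (suc n) = n<ᵇ1+n n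

≤⇒<ᵇ-false : ∀ {m n} → n ≤ m → (m <ᵇ n) ≡ false
≤⇒<ᵇ-false z≤n       = ≡.refl
≤⇒<ᵇ-false (s≤s n≤m) = ≤⇒<ᵇ-false n≤m

<ᵇ-flip : ∀ {m n} → m ≢ n → (n <ᵇ m) ≡ not (m <ᵇ n)
<ᵇ-flip {zero}  {zero}  m≢n = ⊥-elim (m≢n ≡.refl)
<ᵇ-flip {zero}  {suc n} _   = ≡.refl
<ᵇ-flip {suc m} {zero}  _   = ≡.refl
<ᵇ-flip {suc m} {suc n} m≢n = <ᵇ-flip (m≢n ∘ ≡.cong suc)

<ᵇ-skip : ∀ {m n} → n ≢ suc m → n ≢ suc (suc m) → (m <ᵇ n) ≡ (suc (suc m) <ᵇ n)
<ᵇ-skip {m}     {zero}              _   _   = ≡.refl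
<ᵇ-skip {zero}  {suc zero}          n≢1 _   = ⊥-elim (n≢1 ≡.refl)
<ᵇ-skip {zero}  {suc (suc zero)}    _   n≢2 = ⊥-elim (n≢2 ≡.refl)
<ᵇ-skip {zero}  {suc (suc (suc n))} _   _   = ≡.refl
<ᵇ-skip {suc m} {suc n} n≢1+m n≢2+m = <ᵇ-skip (n≢1+m ∘ ≡.cong suc) (n≢2+m ∘ ≡.cong suc)

data ParityView : ℕ → Set where
  even : ∀ k → ParityView (k ℕ.* 2)
  odd  : ∀ k → ParityView (suc (k ℕ.* 2))

parityView : ∀ n → ParityView n
parityView zero          = even 0
parityView (suc zero)    = odd 0
parityView (suc (suc n)) with parityView n
... | even k = even (suc k)
... | odd  k = odd (suc k)

parity-even : ∀ k → parity (k ℕ.* 2) ≡ 0ℙ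
parity-even zero    = ≡.refl
parity-even (suc k) = parity-even k

parity-odd : ∀ k → parity (suc (k ℕ.* 2)) ≡ 1ℙ
parity-odd zero    = ≡.refl
parity-odd (suc k) = parity-odd k

[k*2]%2≡0 : ∀ k → k ℕ.* 2 % 2 ≡ 0
[k*2]%2≡0 k = m*n%n≡0 k 2

[1+k*2]%2≡1 : ∀ k → suc (k ℕ.* 2) % 2 ≡ 1
[1+k*2]%2≡1 k = [m+kn]%n≡m%n 1 k 2

[k*2]/2≡k : ∀ k → k ℕ.* 2 / 2 ≡ k
[k*2]/2≡k k = m*n/n≡m k 2

even≢odd : ∀ k l → k ℕ.* 2 ≢ suc (l ℕ.* 2)
even≢odd (suc k) (suc l) e = even≢odd k l (suc-injective (suc-injective e))

if-swap : ∀ {a} {A : Set a} (p q : Bool) {u v w : A} → (T p → T q → ⊥) →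
          (if p then u else if q then v else w) ≡ (if q then v else if p then u else w)
if-swap true  true  disjoint = ⊥-elim (disjoint _ _)
if-swap true  false _        = ≡.refl
if-swap false q     _        = ≡.refl

module FiniteSums {a ℓ} (M : CommutativeMonoid a ℓ) where
  open CommutativeMonoid M renaming (_∙_ to _+_; ε to 0#; ∙-cong to +-cong; ∙-congˡ to +-congˡ; ∙-congʳ to +-congʳ)

  sumℕ : ℕ → (ℕ → Carrier) → Carrier
  sumℕ zero    f = 0#
  sumℕ (suc k) f = f 0 + sumℕ k (f ∘ suc)

  sumℕ-cong : ∀ k {f g} → (∀ t → t < k → f t ≈ g t) → sumℕ k f ≈ sumℕ k g
  sumℕ-cong zero    f≈g = refl
  sumℕ-cong (suc k) f≈g = +-cong (f≈g 0 (s≤s z≤n)) (sumℕ-cong k λ t t<k → f≈g (suc t) (s≤s t<k))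

  sumℕ-zero : ∀ k f → (∀ t → t < k → f t ≈ 0#) → sumℕ k f ≈ 0#
  sumℕ-zero zero    f f≈0 = refl
  sumℕ-zero (suc k) f f≈0 =
    trans (+-cong (f≈0 0 (s≤s z≤n)) (sumℕ-zero k (f ∘ suc) λ t t<k → f≈0 (suc t) (s≤s t<k))) (identityˡ 0#)

  sumℕ-single : ∀ k f a → a < k → (∀ t → t < k → t ≢ a → f t ≈ 0#) → sumℕ k f ≈ f a
  sumℕ-single (suc k) f zero    _         f≈0 =
    trans (+-congˡ (sumℕ-zero k (f ∘ suc) λ t t<k → f≈0 (suc t) (s≤s t<k) λ ())) (identityʳ _)
  sumℕ-single (suc k) f (suc a) (s≤s a<k) f≈0 =
    trans (+-congʳ (f≈0 0 (s≤s z≤n) λ ())) $ trans (identityˡ _) $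
    sumℕ-single k (f ∘ suc) a a<k λ t t<k t≢a → f≈0 (suc t) (s≤s t<k) (t≢a ∘ suc-injective)

  sumℕ-pair : ∀ k f a b → a < k → b < k → a ≢ b →
              (∀ t → t < k → t ≢ a → t ≢ b → f t ≈ 0#) → sumℕ k f ≈ f a + f b
  sumℕ-pair k       f zero    zero    _ _ a≢b _ = ⊥-elim (a≢b ≡.refl)
  sumℕ-pair (suc k) f zero    (suc b) _ (s≤s b<k) _ f≈0 =
    +-congˡ (sumℕ-single k (f ∘ suc) b b<k λ t t<k t≢b → f≈0 (suc t) (s≤s t<k) (λ ()) (t≢b ∘ suc-injective))
  sumℕ-pair (suc k) f (suc a) zero    (s≤s a<k) _ _ f≈0 =
    trans (+-congˡ (sumℕ-single k (f ∘ suc) a a<k λ t t<k t≢a →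
                     f≈0 (suc t) (s≤s t<k) (t≢a ∘ suc-injective) λ ()))
          (comm _ _)
  sumℕ-pair (suc k) f (suc a) (suc b) (s≤s a<k) (s≤s b<k) a≢b f≈0 =
    trans (+-congʳ (f≈0 0 (s≤s z≤n) (λ ()) (λ ()))) $ trans (identityˡ _) $
    sumℕ-pair k (f ∘ suc) a b a<k b<k (a≢b ∘ ≡.cong suc)
      λ t t<k t≢a t≢b → f≈0 (suc t) (s≤s t<k) (t≢a ∘ suc-injective) (t≢b ∘ suc-injective)

module CyclicTridiagonal {c ℓ : Level} (Rng : CommutativeRing c ℓ) where
  open CommutativeRing Rng
  open Matrices Rng
  open FiniteSums +-commutativeMonoid
  open import Algebra.Properties.Ring ring using (-‿distribˡ-*; -‿distribʳ-*; -‿involutive)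
  open import Algebra.Properties.CommutativeSemigroup *-commutativeSemigroup using (x∙yz≈y∙xz)
  open import Algebra.Solver.Ring.NaturalCoefficients.Default commutativeSemiring
  open import Relation.Binary.Reasoning.Setoid setoid

  ≡0#⇒*≈0# : ∀ {e} a → e ≡ 0# → e * a ≈ 0#
  ≡0#⇒*≈0# a ≡.refl = zeroˡ a

  -x*-y≈x*y : ∀ a b → - a * - b ≈ a * b
  -x*-y≈x*y a b = begin
    - a * - b      ≈⟨ -‿distribˡ-* a (- b) ⟨
    - (a * - b)    ≈⟨ -‿cong (-‿distribʳ-* a b) ⟨
    - - (a * b)    ≈⟨ -‿involutive (a * b) ⟩
    a * b          ∎

  -x*[-y*z]≈x*[y*z] : ∀ a b z → - a * (- b * z) ≈ a * (b * z)
  -x*[-y*z]≈x*[y*z] a b z = trans (*-congˡ (sym (-‿distribˡ-* b z))) (-x*-y≈x*y a (b * z))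

  -1*[-x*y]≈x*y : ∀ a b → - 1# * (- a * b) ≈ a * b
  -1*[-x*y]≈x*y a b = trans (*-congˡ (sym (-‿distribˡ-* a b))) (trans (-x*-y≈x*y 1# (a * b)) (*-identityˡ _))

  x*[y*-z]≈-[x*[y*z]] : ∀ a b e → a * (b * - e) ≈ - (a * (b * e))
  x*[y*-z]≈-[x*[y*z]] a b e = trans (*-congˡ (sym (-‿distribʳ-* b e))) (sym (-‿distribʳ-* a (b * e)))

  sumFin-toℕ : ∀ k (f : ℕ → Carrier) → sumFin {k} (f ∘ toℕ) ≡ sumℕ k f
  sumFin-toℕ zero    f = ≡.refl
  sumFin-toℕ (suc k) f = ≡.cong (f 0 +_) (sumFin-toℕ k (f ∘ suc))

  sumℕ-two-entries : ∀ k (e v : ℕ → Carrier) a b → a < k → b < k → a ≢ b →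
                     (∀ t → t < k → t ≢ a → t ≢ b → e t ≡ 0#) →
                     sumℕ k (λ t → e t * v t) ≈ e a * v a + e b * v b
  sumℕ-two-entries k e v a b a<k b<k a≢b e≡0 =
    sumℕ-pair k (λ t → e t * v t) a b a<k b<k a≢b λ t t<k t≢a t≢b → ≡0#⇒*≈0# (v t) (e≡0 t t<k t≢a t≢b)

  -- Tmat n x y i j, Rmat n i j, uvec n j and idMat i j unfold to these at N = 2 * n and indices toℕ i, toℕ j.
  Tℕ : ℕ → Carrier → Carrier → ℕ → ℕ → Carrier
  Tℕ N x y i j =
    if (j ≡ᵇ suc i) ∨ (i ≡ᵇ suc j) then 1#
    else if (i ≡ᵇ 0) ∧ (j ≡ᵇ N) then y
    else if (i ≡ᵇ N) ∧ (j ≡ᵇ 0) then x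
    else 0#

  Rℕ : ℕ → ℕ → Carrier
  Rℕ i j = if (j % 2 ≡ᵇ 0) ∧ (i ≡ᵇ suc j) then 1# else 0#

  uℕ : ℕ → Carrier
  uℕ j = if j % 2 ≡ᵇ 0 then signPow (j / 2) else 0#

  δℕ : ℕ → ℕ → Carrier
  δℕ i j = if i ≡ᵇ j then 1# else 0#

  Tℕ-transpose : ∀ N x y i j → N ≢ 0 → Tℕ N x y i j ≡ Tℕ N y x j i
  Tℕ-transpose N x y i j N≢0
    rewrite ∨-comm (j ≡ᵇ suc i) (i ≡ᵇ suc j) | ∧-comm (j ≡ᵇ 0) (i ≡ᵇ N) | ∧-comm (j ≡ᵇ N) (i ≡ᵇ 0) =
    ≡.cong (if (i ≡ᵇ suc j) ∨ (j ≡ᵇ suc i) then 1# else_)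
           (if-swap ((i ≡ᵇ 0) ∧ (j ≡ᵇ N)) ((i ≡ᵇ N) ∧ (j ≡ᵇ 0)) corners-disjoint)
    where
    corners-disjoint : T ((i ≡ᵇ 0) ∧ (j ≡ᵇ N)) → T ((i ≡ᵇ N) ∧ (j ≡ᵇ 0)) → ⊥
    corners-disjoint i≡0 i≡N = N≢0 (≡.trans (≡.sym (≡ᵇ⇒≡ i N (proj₁ (Equivalence.to T-∧ i≡N))))
                                            (≡ᵇ⇒≡ i 0 (proj₁ (Equivalence.to T-∧ i≡0))))

  Tℕ-first-row : ∀ M x y v →
    sumℕ (3 ℕ.+ M) (λ t → Tℕ (2 ℕ.+ M) x y 0 t * v t) ≈ v 1 + y * v (2 ℕ.+ M)
  Tℕ-first-row M x y v =
    trans (sumℕ-two-entries (3 ℕ.+ M) _ v 1 (2 ℕ.+ M) (s≤s (s≤s z≤n)) (n<1+n (2 ℕ.+ M)) (λ ()) off)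
          (+-cong (*-identityˡ _) (*-congʳ (reflexive corner)))
    where
    corner : Tℕ (2 ℕ.+ M) x y 0 (2 ℕ.+ M) ≡ y
    corner rewrite ≡ᵇ-refl M = ≡.refl
    off : ∀ t → t < 3 ℕ.+ M → t ≢ 1 → t ≢ 2 ℕ.+ M → Tℕ (2 ℕ.+ M) x y 0 t ≡ 0#
    off t _ t≢1 t≢N rewrite ≢⇒≡ᵇ-false t≢1 | ≢⇒≡ᵇ-false t≢N = ≡.refl

  Tℕ-middle-row : ∀ N x y i v → suc (suc i) ≤ N →
    sumℕ (suc N) (λ t → Tℕ N x y (suc i) t * v t) ≈ v i + v (suc (suc i))
  Tℕ-middle-row N x y i v 2+i≤N =
    trans (sumℕ-two-entries (suc N) _ v i (suc (suc i)) i<1+N (s≤s 2+i≤N) (m≢1+n+m i) off)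
          (+-cong (trans (*-congʳ (reflexive below)) (*-identityˡ _)) (trans (*-congʳ (reflexive above)) (*-identityˡ _)))
    where
    i<1+N : i < suc N
    i<1+N = ≤-trans (n≤1+n (suc i)) (m≤n⇒m≤1+n 2+i≤N)
    below : Tℕ N x y (suc i) i ≡ 1#
    below rewrite ≢⇒≡ᵇ-false (m≢1+n+m i {1}) | ≡ᵇ-refl i = ≡.refl
    above : Tℕ N x y (suc i) (suc (suc i)) ≡ 1#
    above rewrite ≡ᵇ-refl i = ≡.refl
    off : ∀ t → t < suc N → t ≢ i → t ≢ suc (suc i) → Tℕ N x y (suc i) t ≡ 0#
    off t _ t≢i t≢2+i
      rewrite ≢⇒≡ᵇ-false t≢2+i | ≢⇒≡ᵇ-false (t≢i ∘ ≡.sym) | ≢⇒≡ᵇ-false (<⇒≢ 2+i≤N) = ≡.refl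

  Tℕ-last-row : ∀ M x y v →
    sumℕ (3 ℕ.+ M) (λ t → Tℕ (2 ℕ.+ M) x y (2 ℕ.+ M) t * v t) ≈ x * v 0 + v (suc M)
  Tℕ-last-row M x y v =
    trans (sumℕ-two-entries (3 ℕ.+ M) _ v 0 (suc M) (s≤s z≤n) (m<n⇒m<1+n (n<1+n (suc M))) (λ ()) off)
          (+-cong (*-congʳ (reflexive corner)) (trans (*-congʳ (reflexive below)) (*-identityˡ _)))
    where
    corner : Tℕ (2 ℕ.+ M) x y (2 ℕ.+ M) 0 ≡ x
    corner rewrite ≡ᵇ-refl M = ≡.refl
    below : Tℕ (2 ℕ.+ M) x y (2 ℕ.+ M) (suc M) ≡ 1#
    below rewrite ≢⇒≡ᵇ-false (m≢1+n+m M {1}) | ≡ᵇ-refl M = ≡.refl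
    off : ∀ t → t < 3 ℕ.+ M → t ≢ 0 → t ≢ suc M → Tℕ (2 ℕ.+ M) x y (2 ℕ.+ M) t ≡ 0#
    off t t<3+M t≢0 t≢1+M
      rewrite ≢⇒≡ᵇ-false (<⇒≢ t<3+M) | ≢⇒≡ᵇ-false (t≢1+M ∘ ≡.sym) | ≡ᵇ-refl M | ≢⇒≡ᵇ-false t≢0
      = ≡.refl

  Rℕ-even-column : ∀ K k (v : ℕ → Carrier) → suc (k ℕ.* 2) < K →
    sumℕ K (λ a → Rℕ a (k ℕ.* 2) * v a) ≈ v (suc (k ℕ.* 2))
  Rℕ-even-column K k v 1+2k<K =
    trans (sumℕ-single K (λ a → Rℕ a (k ℕ.* 2) * v a) (suc (k ℕ.* 2)) 1+2k<K
                       λ a _ a≢1+2k → ≡0#⇒*≈0# (v a) (off a a≢1+2k))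
          (trans (*-congʳ (reflexive hit)) (*-identityˡ _))
    where
    hit : Rℕ (suc (k ℕ.* 2)) (k ℕ.* 2) ≡ 1#
    hit rewrite [k*2]%2≡0 k | ≡ᵇ-refl (k ℕ.* 2) = ≡.refl
    off : ∀ a → a ≢ suc (k ℕ.* 2) → Rℕ a (k ℕ.* 2) ≡ 0#
    off a a≢1+2k rewrite [k*2]%2≡0 k | ≢⇒≡ᵇ-false a≢1+2k = ≡.refl

  Rℕ-odd-column : ∀ K k (v : ℕ → Carrier) → sumℕ K (λ a → Rℕ a (suc (k ℕ.* 2)) * v a) ≈ 0#
  Rℕ-odd-column K k v = sumℕ-zero K (λ a → Rℕ a (suc (k ℕ.* 2)) * v a) λ a _ → ≡0#⇒*≈0# (v a) (off a)
    where
    off : ∀ a → Rℕ a (suc (k ℕ.* 2)) ≡ 0#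
    off a rewrite [1+k*2]%2≡1 k = ≡.refl

  uℕ-even : ∀ k → uℕ (k ℕ.* 2) ≡ signPow k
  uℕ-even k rewrite [k*2]%2≡0 k | [k*2]/2≡k k = ≡.refl

  uℕ-odd : ∀ k → uℕ (suc (k ℕ.* 2)) ≡ 0#
  uℕ-odd k rewrite [1+k*2]%2≡1 k = ≡.refl

  sign : ℕ → Carrier
  sign zero          = 1#
  sign (suc zero)    = 1#
  sign (suc (suc i)) = - sign i

  sign-even : ∀ k → sign (k ℕ.* 2) ≡ signPow k
  sign-even zero    = ≡.refl
  sign-even (suc k) = ≡.cong -_ (sign-even k)

  sign-odd : ∀ k → sign (suc (k ℕ.* 2)) ≡ signPow k
  sign-odd zero    = ≡.refl
  sign-odd (suc k) = ≡.cong -_ (sign-odd k)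

  sign²≈1 : ∀ i → sign i * sign i ≈ 1#
  sign²≈1 zero          = *-identityˡ 1#
  sign²≈1 (suc zero)    = *-identityˡ 1#
  sign²≈1 (suc (suc i)) = trans (-x*-y≈x*y (sign i) (sign i)) (sign²≈1 i)

  -- n = suc m, and N = 2n is the last index.
  module Inverse (m : ℕ) (x y d : Carrier) where

    N : ℕ
    N = suc m ℕ.* 2

    s : Carrier
    s = sign N

    -- kernel (parity i) (parity j) (i <ᵇ j) is the (i, j) entry of the inverse divided by sign i · sign j · d.
    kernel : Parity → Parity → Bool → Carrier
    kernel 0ℙ 0ℙ _     = s
    kernel 1ℙ 1ℙ _     = s * (x * y)
    kernel 0ℙ 1ℙ true  = y
    kernel 0ℙ 1ℙ false = - x
    kernel 1ℙ 0ℙ true  = - y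
    kernel 1ℙ 0ℙ false = x

    inverse : ℕ → ℕ → Carrier
    inverse i j = sign i * (sign j * (kernel (parity i) (parity j) (i <ᵇ j) * d))

    kernel-diagonal : ∀ p b b′ → kernel p p b ≡ kernel p p b′
    kernel-diagonal 0ℙ _ _ = ≡.refl
    kernel-diagonal 1ℙ _ _ = ≡.refl

    kernel-step : ∀ i j → j ≢ suc i →
      kernel (parity i) (parity j) (i <ᵇ j) ≡ kernel (parity i) (parity j) (suc (suc i) <ᵇ j)
    kernel-step i j j≢1+i with j ≟ suc (suc i)
    ... | yes ≡.refl = kernel-diagonal (parity i) _ _
    ... | no  j≢2+i  = ≡.cong (kernel (parity i) (parity j)) (<ᵇ-skip j≢1+i j≢2+i)

    inverse-step : ∀ i j → j ≢ suc i → inverse (suc (suc i)) j ≈ - inverse i j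
    inverse-step i j j≢1+i = begin
      - sign i * (sign j * (kernel (parity i) (parity j) (suc (suc i) <ᵇ j) * d))
        ≈⟨ -‿distribˡ-* _ _ ⟨
      - (sign i * (sign j * (kernel (parity i) (parity j) (suc (suc i) <ᵇ j) * d)))
        ≡⟨ ≡.cong (λ k → - (sign i * (sign j * (k * d)))) (kernel-step i j j≢1+i) ⟨
      - inverse i j ∎

    first-row-factor : ∀ j → inverse 1 j + y * inverse N j ≈
      sign j * ((kernel 1ℙ (parity j) (1 <ᵇ j) + y * (s * kernel 0ℙ (parity j) (N <ᵇ j))) * d)
    first-row-factor j rewrite parity-even m =
      solve 6 (λ σ k₁ k₂ y s d → con 1 :* (σ :* (k₁ :* d)) :+ y :* (s :* (σ :* (k₂ :* d)))
                              := σ :* ((k₁ :+ y :* (s :* k₂)) :* d))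
              refl (sign j) _ _ y s d

    sign[N-1]≈-s : sign (suc (m ℕ.* 2)) ≈ - s
    sign[N-1]≈-s = trans (reflexive (≡.trans (sign-odd m) (≡.sym (sign-even m)))) (sym (-‿involutive _))

    last-row-factor : ∀ j → x * inverse 0 j + inverse (suc (m ℕ.* 2)) j ≈
      sign j * ((x * kernel 0ℙ (parity j) (0 <ᵇ j) + - s * kernel 1ℙ (parity j) (suc (m ℕ.* 2) <ᵇ j)) * d)
    last-row-factor j rewrite parity-odd m =
      trans (solve 6 (λ σ k₁ k₂ x r d → x :* (con 1 :* (σ :* (k₁ :* d))) :+ r :* (σ :* (k₂ :* d))
                                     := σ :* ((x :* k₁ :+ r :* k₂) :* d))
                     refl (sign j) _ _ x (sign (suc (m ℕ.* 2))) d)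
            (*-congˡ (*-congʳ (+-congˡ (*-congʳ sign[N-1]≈-s))))

    factor≈0 : ∀ σ {B} → B ≈ 0# → σ * (B * d) ≈ 0#
    factor≈0 σ B≈0 = trans (*-congˡ (trans (*-congʳ B≈0) (zeroˡ d))) (zeroʳ σ)

    y*s²≈y : y * (s * s) ≈ y
    y*s²≈y = trans (*-congˡ (sign²≈1 N)) (*-identityʳ y)

    module _ (x+y·d≈1 : (x + y) * d ≈ 1#) where

      yd+xd≈1 : y * d + x * d ≈ 1#
      yd+xd≈1 = trans (sym (distribʳ d y x)) (trans (*-congʳ (+-comm y x)) x+y·d≈1)

      inverse-jump : ∀ i → inverse i (suc i) + inverse (suc (suc i)) (suc i) ≈ 1#
      inverse-jump zero =
        trans (+-cong (trans (*-identityˡ _) (*-identityˡ _)) (trans (*-congˡ (*-identityˡ _)) (-1*[-x*y]≈x*y x d)))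
              yd+xd≈1
      inverse-jump (suc zero) =
        trans (+-cong (trans (*-identityˡ _) (-1*[-x*y]≈x*y y d))
                      (trans (-x*[-y*z]≈x*[y*z] 1# 1# (x * d)) (trans (*-identityˡ _) (*-identityˡ _))))
              yd+xd≈1
      inverse-jump (suc (suc i)) =
        trans (+-cong (-x*[-y*z]≈x*[y*z] _ _ _) (-x*[-y*z]≈x*[y*z] _ _ _)) (inverse-jump i)

      inverse-middle-row : ∀ i j → inverse i j + inverse (suc (suc i)) j ≈ δℕ (suc i) j
      inverse-middle-row i j with j ≟ suc i
      ... | yes ≡.refl rewrite ≡ᵇ-refl i = inverse-jump i
      ... | no  j≢1+i  rewrite ≢⇒≡ᵇ-false (j≢1+i ∘ ≡.sym) =
        trans (+-congˡ (inverse-step i j j≢1+i)) (-‿inverseʳ _)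

      first-row-kernels : ∀ j → j ≤ N →
        sign j * ((kernel 1ℙ (parity j) (1 <ᵇ j) + y * (s * kernel 0ℙ (parity j) (N <ᵇ j))) * d) ≈ δℕ 0 j
      first-row-kernels j j≤N with parityView j
      ... | even zero = trans (*-identityˡ _) (trans (*-congʳ (+-congˡ y*s²≈y)) x+y·d≈1)
      ... | even (suc k) rewrite parity-even (suc k) =
        factor≈0 _ (trans (+-congˡ y*s²≈y) (-‿inverseˡ y))
      ... | odd k rewrite parity-odd k | ≤⇒<ᵇ-false j≤N =
        factor≈0 _ (trans (+-congˡ y[s*-x]≈-[s[xy]]) (-‿inverseʳ _))
        where
        y[s*-x]≈-[s[xy]] : y * (s * - x) ≈ - (s * (x * y))
        y[s*-x]≈-[s[xy]] =
          trans (x*[y*-z]≈-[x*[y*z]] y s x) (-‿cong (trans (x∙yz≈y∙xz y s x) (*-congˡ (*-comm y x))))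

      inverse-first-row : ∀ j → j ≤ N → inverse 1 j + y * inverse N j ≈ δℕ 0 j
      inverse-first-row j j≤N = trans (first-row-factor j) (first-row-kernels j j≤N)

      last-row-kernels : ∀ j → j ≤ N →
        sign j * ((x * kernel 0ℙ (parity j) (0 <ᵇ j) + - s * kernel 1ℙ (parity j) (suc (m ℕ.* 2) <ᵇ j)) * d)
          ≈ δℕ N j
      last-row-kernels j j≤N with parityView j
      ... | odd k rewrite parity-odd k | ≢⇒≡ᵇ-false (even≢odd (suc m) k) =
        factor≈0 _ (trans (+-congˡ -s[s[xy]]≈-[xy]) (-‿inverseʳ _))
        where
        -s[s[xy]]≈-[xy] : - s * (s * (x * y)) ≈ - (x * y)
        -s[s[xy]]≈-[xy] = trans (sym (-‿distribˡ-* s _))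
                                (-‿cong (trans (sym (*-assoc s s _)) (trans (*-congʳ (sign²≈1 N)) (*-identityˡ _))))
      ... | even k with m≤n⇒m<n∨m≡n (*-cancelʳ-≤ k (suc m) 2 j≤N)
      ...   | inj₂ ≡.refl rewrite parity-even (suc m) | n<ᵇ1+n (m ℕ.* 2) | ≡ᵇ-refl (m ℕ.* 2) = begin
        s * ((x * s + - s * - y) * d)  ≈⟨ *-congˡ (*-congʳ (+-congˡ (-x*-y≈x*y s y))) ⟩
        s * ((x * s + s * y) * d)
          ≈⟨ solve 4 (λ s x y d → s :* ((x :* s :+ s :* y) :* d) := (s :* s) :* ((x :+ y) :* d)) refl s x y d ⟩
        (s * s) * ((x + y) * d)        ≈⟨ *-cong (sign²≈1 N) x+y·d≈1 ⟩
        1# * 1#                        ≈⟨ *-identityˡ 1# ⟩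
        1#                             ∎
      ...   | inj₁ (s≤s k≤m) with m≤n⇒m≤1+n (*-monoˡ-≤ 2 k≤m)
      ...     | 2k≤N-1 rewrite parity-even k | ≤⇒<ᵇ-false 2k≤N-1 | ≢⇒≡ᵇ-false (<⇒≢ (s≤s 2k≤N-1) ∘ ≡.sym) =
        factor≈0 _ (trans (+-cong (*-comm x s) (sym (-‿distribˡ-* s x))) (-‿inverseʳ _))

      inverse-last-row : ∀ j → j ≤ N → x * inverse 0 j + inverse (suc (m ℕ.* 2)) j ≈ δℕ N j
      inverse-last-row j j≤N = trans (last-row-factor j) (last-row-kernels j j≤N)

      Tℕ·inverse : ∀ i j → i ≤ N → j ≤ N → sumℕ (suc N) (λ t → Tℕ N x y i t * inverse t j) ≈ δℕ i j
      Tℕ·inverse zero    j _   j≤N = trans (Tℕ-first-row (m ℕ.* 2) x y (λ t → inverse t j)) (inverse-first-row j j≤N)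
      Tℕ·inverse (suc i) j i<N j≤N with m≤n⇒m<n∨m≡n i<N
      ... | inj₁ 2+i≤N  = trans (Tℕ-middle-row N x y i (λ t → inverse t j) 2+i≤N) (inverse-middle-row i j)
      ... | inj₂ ≡.refl = trans (Tℕ-last-row (m ℕ.* 2) x y (λ t → inverse t j)) (inverse-last-row j j≤N)

    Rᵀ·inverse·R : ∀ K J L → suc J < K → suc L < K →
      sumℕ K (λ t → sumℕ K (λ a → Rℕ a J * inverse a t) * Rℕ t L)
        ≈ (signPow (suc m) * ((x * y) * d)) * (uℕ J * uℕ L)
    Rᵀ·inverse·R K J L 1+J<K 1+L<K with parityView J | parityView L
    ... | odd k | _ rewrite uℕ-odd k = begin
      sumℕ K (λ t → sumℕ K (λ a → Rℕ a (suc (k ℕ.* 2)) * inverse a t) * Rℕ t L)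
        ≈⟨ sumℕ-zero K _ (λ t _ → trans (*-congʳ (Rℕ-odd-column K k (λ a → inverse a t))) (zeroˡ _)) ⟩
      0#
        ≈⟨ trans (*-congˡ (zeroˡ _)) (zeroʳ _) ⟨
      (signPow (suc m) * ((x * y) * d)) * (0# * uℕ L) ∎
    ... | even k | odd l rewrite uℕ-odd l = begin
      sumℕ K (λ t → sumℕ K (λ a → Rℕ a (k ℕ.* 2) * inverse a t) * Rℕ t (suc (l ℕ.* 2)))
        ≈⟨ sumℕ-cong K (λ t _ → *-comm _ _) ⟩
      sumℕ K (λ t → Rℕ t (suc (l ℕ.* 2)) * sumℕ K (λ a → Rℕ a (k ℕ.* 2) * inverse a t))
        ≈⟨ Rℕ-odd-column K l _ ⟩
      0#
        ≈⟨ trans (*-congˡ (zeroʳ _)) (zeroʳ _) ⟨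
      (signPow (suc m) * ((x * y) * d)) * (uℕ (k ℕ.* 2) * 0#) ∎
    ... | even k | even l rewrite uℕ-even k | uℕ-even l = begin
      sumℕ K (λ t → sumℕ K (λ a → Rℕ a (k ℕ.* 2) * inverse a t) * Rℕ t (l ℕ.* 2))
        ≈⟨ sumℕ-cong K (λ t _ → trans (*-comm _ _) (*-congˡ (Rℕ-even-column K k (λ a → inverse a t) 1+J<K))) ⟩
      sumℕ K (λ t → Rℕ t (l ℕ.* 2) * inverse (suc (k ℕ.* 2)) t)
        ≈⟨ Rℕ-even-column K l (inverse (suc (k ℕ.* 2))) 1+L<K ⟩
      inverse (suc (k ℕ.* 2)) (suc (l ℕ.* 2))
        ≡⟨ odd-entry ⟩
      signPow k * (signPow l * ((signPow (suc m) * (x * y)) * d))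
        ≈⟨ solve 6 (λ a b c x y d → a :* (b :* ((c :* (x :* y)) :* d)) := (c :* ((x :* y) :* d)) :* (a :* b))
                   refl (signPow k) (signPow l) (signPow (suc m)) x y d ⟩
      (signPow (suc m) * ((x * y) * d)) * (signPow k * signPow l) ∎
      where
      odd-entry : inverse (suc (k ℕ.* 2)) (suc (l ℕ.* 2)) ≡ signPow k * (signPow l * ((signPow (suc m) * (x * y)) * d))
      odd-entry rewrite sign-odd k | sign-odd l | parity-odd k | parity-odd l | sign-even (suc m) = ≡.refl

  module InverseTranspose (m : ℕ) (x y d : Carrier) where
    open Inverse m x y d
    private module Swapped = Inverse m y x d

    kernel-transpose : ∀ p q b → kernel p q b ≈ Swapped.kernel q p (not b)
    kernel-transpose 0ℙ 0ℙ _     = refl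
    kernel-transpose 1ℙ 1ℙ _     = *-congˡ (*-comm x y)
    kernel-transpose 0ℙ 1ℙ true  = refl
    kernel-transpose 0ℙ 1ℙ false = refl
    kernel-transpose 1ℙ 0ℙ true  = refl
    kernel-transpose 1ℙ 0ℙ false = refl

    inverse-transpose : ∀ i j → inverse i j ≈ Swapped.inverse j i
    inverse-transpose i j = trans (x∙yz≈y∙xz (sign i) (sign j) _) (*-congˡ (*-congˡ (*-congʳ kernel≈)))
      where
      kernel≈ : kernel (parity i) (parity j) (i <ᵇ j) ≈ Swapped.kernel (parity j) (parity i) (j <ᵇ i)
      kernel≈ with i ≟ j
      ... | yes ≡.refl = trans (kernel-transpose (parity i) (parity i) (i <ᵇ i))
                               (reflexive (Swapped.kernel-diagonal (parity i) _ _))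
      ... | no  i≢j rewrite <ᵇ-flip i≢j = kernel-transpose (parity i) (parity j) (i <ᵇ j)

    inverse·Tℕ : (x + y) * d ≈ 1# → ∀ i j → i ≤ N → j ≤ N →
                 sumℕ (suc N) (λ t → inverse i t * Tℕ N x y t j) ≈ δℕ i j
    inverse·Tℕ x+y·d≈1 i j i≤N j≤N = begin
      sumℕ (suc N) (λ t → inverse i t * Tℕ N x y t j)
        ≈⟨ sumℕ-cong (suc N) (λ t _ → trans (*-comm _ _)
                                            (*-cong (reflexive (Tℕ-transpose N x y t j λ ())) (inverse-transpose i t))) ⟩
      sumℕ (suc N) (λ t → Tℕ N y x j t * Swapped.inverse t i)
        ≈⟨ Swapped.Tℕ·inverse (trans (*-congʳ (+-comm y x)) x+y·d≈1) j i j≤N i≤N ⟩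
      δℕ j i
        ≡⟨ ≡.cong (if_then 1# else 0#) (≡ᵇ-sym j i) ⟩
      δℕ i j ∎

  module InverseMatrix (m : ℕ) (x y d : Carrier) where
    open Inverse m x y d
    open InverseTranspose m x y d

    inverseMat : Mat (2 ℕ.* suc m ℕ.+ 1) (2 ℕ.* suc m ℕ.+ 1)
    inverseMat i j = inverse (toℕ i) (toℕ j)

    2n≡N : 2 ℕ.* suc m ≡ N
    2n≡N = ℕP.*-comm 2 (suc m)

    sumℕ-resize : (F : ℕ → ℕ → Carrier) →
                  sumℕ (2 ℕ.* suc m ℕ.+ 1) (F (2 ℕ.* suc m)) ≡ sumℕ (suc N) (F N)
    sumℕ-resize F =
      ≡.trans (≡.cong (λ M → sumℕ (M ℕ.+ 1) (F M)) 2n≡N) (≡.cong (λ k → sumℕ k (F N)) (ℕP.+-comm N 1))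

    toℕ≤N : (i : Fin (2 ℕ.* suc m ℕ.+ 1)) → toℕ i ≤ N
    toℕ≤N i =
      ℕP.≤-pred (≡.subst (toℕ i <_) (≡.trans (ℕP.+-comm (2 ℕ.* suc m) 1) (≡.cong suc 2n≡N)) (toℕ<n i))

    1+toℕ<2n+1 : (j : Fin (2 ℕ.* suc m ℕ.∸ 1)) → suc (toℕ j) < 2 ℕ.* suc m ℕ.+ 1
    1+toℕ<2n+1 j = ≡.subst (suc (toℕ j) <_) (ℕP.+-comm 1 (2 ℕ.* suc m))
                           (s≤s (ℕP.≤-trans (toℕ<n j) (ℕP.m∸n≤m (2 ℕ.* suc m) 1)))

    Tmat·inverseMat : (x + y) * d ≈ 1# → (Tmat (suc m) x y · inverseMat) ≋ idMat
    Tmat·inverseMat x+y·d≈1 i j = begin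
      (Tmat (suc m) x y · inverseMat) i j
        ≡⟨ sumFin-toℕ (2 ℕ.* suc m ℕ.+ 1) (λ t → Tℕ (2 ℕ.* suc m) x y (toℕ i) t * inverse t (toℕ j)) ⟩
      sumℕ (2 ℕ.* suc m ℕ.+ 1) (λ t → Tℕ (2 ℕ.* suc m) x y (toℕ i) t * inverse t (toℕ j))
        ≡⟨ sumℕ-resize (λ M t → Tℕ M x y (toℕ i) t * inverse t (toℕ j)) ⟩
      sumℕ (suc N) (λ t → Tℕ N x y (toℕ i) t * inverse t (toℕ j))
        ≈⟨ Tℕ·inverse x+y·d≈1 (toℕ i) (toℕ j) (toℕ≤N i) (toℕ≤N j) ⟩
      δℕ (toℕ i) (toℕ j) ∎

    inverseMat·Tmat : (x + y) * d ≈ 1# → (inverseMat · Tmat (suc m) x y) ≋ idMat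
    inverseMat·Tmat x+y·d≈1 i j = begin
      (inverseMat · Tmat (suc m) x y) i j
        ≡⟨ sumFin-toℕ (2 ℕ.* suc m ℕ.+ 1) (λ t → inverse (toℕ i) t * Tℕ (2 ℕ.* suc m) x y t (toℕ j)) ⟩
      sumℕ (2 ℕ.* suc m ℕ.+ 1) (λ t → inverse (toℕ i) t * Tℕ (2 ℕ.* suc m) x y t (toℕ j))
        ≡⟨ sumℕ-resize (λ M t → inverse (toℕ i) t * Tℕ M x y t (toℕ j)) ⟩
      sumℕ (suc N) (λ t → inverse (toℕ i) t * Tℕ N x y t (toℕ j))
        ≈⟨ inverse·Tℕ x+y·d≈1 (toℕ i) (toℕ j) (toℕ≤N i) (toℕ≤N j) ⟩
      δℕ (toℕ i) (toℕ j) ∎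

    Rᵀ·inverseMat·R : ((transpose (Rmat (suc m)) · inverseMat) · Rmat (suc m))
                      ≋ scale (signPow (suc m) * ((x * y) * d)) (outer (uvec (suc m)) (uvec (suc m)))
    Rᵀ·inverseMat·R j l = begin
      ((transpose (Rmat (suc m)) · inverseMat) · Rmat (suc m)) j l
        ≡⟨ sumFin-toℕ K (λ t → sumFin {K} (λ a → Rℕ (toℕ a) (toℕ j) * inverse (toℕ a) t) * Rℕ t (toℕ l))
        ⟩
      sumℕ K (λ t → sumFin {K} (λ a → Rℕ (toℕ a) (toℕ j) * inverse (toℕ a) t) * Rℕ t (toℕ l))
        ≈⟨ sumℕ-cong K {g = λ t → sumℕ K (λ a → Rℕ a (toℕ j) * inverse a t) * Rℕ t (toℕ l)}
                      (λ t _ → *-congʳ (reflexive (sumFin-toℕ K (λ a → Rℕ a (toℕ j) * inverse a t)))) ⟩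
      sumℕ K (λ t → sumℕ K (λ a → Rℕ a (toℕ j) * inverse a t) * Rℕ t (toℕ l))
        ≈⟨ Rᵀ·inverse·R K (toℕ j) (toℕ l) (1+toℕ<2n+1 j) (1+toℕ<2n+1 l) ⟩
      (signPow (suc m) * ((x * y) * d)) * (uℕ (toℕ j) * uℕ (toℕ l)) ∎
      where
      K : ℕ
      K = 2 ℕ.* suc m ℕ.+ 1

lemma8p1 : {c ℓ : Level} (Rng : CommutativeRing c ℓ) →
    let open CommutativeRing Rng in
    let open Matrices Rng in
    (n : ℕ) → 1 ≤ n → (x y d : Carrier) → (x + y) * d ≈ 1# →
    Σ (Mat _ _) (λ S →
      (Tmat n x y · S) ≋ idMat ×
      (S · Tmat n x y) ≋ idMat ×
      ((transpose (Rmat n) · S) · Rmat n)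
        ≋ scale (signPow n * ((x * y) * d)) (outer (uvec n) (uvec n)))
lemma8p1 Rng (suc m) _ x y d x+y·d≈1 =
  inverseMat , Tmat·inverseMat x+y·d≈1 , inverseMat·Tmat x+y·d≈1 , Rᵀ·inverseMat·R
  where open CyclicTridiagonal.InverseMatrix Rng m x y d
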